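{- Let $P=(X,\leq_P)$ be a connected finite poset with at least two points, let $Q$ be a connected finite flat poset, and let $f:E(P)\to Q$ be an order homomorphism. For $x\in X$ put $\alpha(x)=f[L(P)\cap{\downarrow}_P x]$ and $\beta(x)=f[U(P)\cap{\uparrow}_P x]$. Suppose that for all $x\in X$ with $\alpha(x)\cap\beta(x)=\emptyset$ we have: $\#\alpha(x)\ge 2\Rightarrow\#\beta(x)=1$ and $\#\beta(x)\ge2\Rightarrow\#\alpha(x)=1$. Then there exists an order homomorphism $g:P\to Q$ with $g|_{E(P)}=f$.
   Context: $L(P)$, $U(P)$: minimal and maximal points; $E(P)=L(P)\cup U(P)$ as induced subposet. ${\downarrow}_P x=\{y: y\leq_P x\}$, ${\uparrow}_P x=\{y: x\leq_P y\}$. A poset is flat if it has height one (its longest chains have two elements). -}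

module Defs where

open import Level using (0ℓ)
open import Data.Nat using (ℕ)
open import Data.Fin using (Fin)
open import Data.Product using (Σ; ∃; _×_; _,_)
open import Data.Sum using (_⊎_)
open import Relation.Nullary using (¬_)
open import Relation.Binary.PropositionalEquality using (_≡_; _≢_)
open import Relation.Binary.Definitions using (Decidable)
open import Relation.Binary.Structures using (IsPartialOrder)
open import Relation.Binary.Construct.Closure.ReflexiveTransitive using (Star)

record FinPoset : Set₁ where
  field
    size          : ℕ
    _≤_           : Fin size → Fin size → Set
    isPartialOrder : IsPartialOrder _≡_ _≤_
    _≤?_          : Decidable _≤_

  Carrier : Set
  Carrier = Fin size

  _<_ : Carrier → Carrier → Set
  x < y = x ≤ y × x ≢ y

  Comparable : Carrier → Carrier → Set
  Comparable x y = x ≤ y ⊎ y ≤ x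

  -- L(P): minimal points, U(P): maximal points, E(P) = L(P) ∪ U(P)
  Minimal : Carrier → Set
  Minimal x = ∀ y → y ≤ x → y ≡ x

  Maximal : Carrier → Set
  Maximal x = ∀ y → x ≤ y → y ≡ x

  Extremal : Carrier → Set
  Extremal x = Minimal x ⊎ Maximal x

open FinPoset public

Connected : FinPoset → Set
Connected P = ∀ x y → Star (Comparable P) x y

Flat : FinPoset → Set
Flat P = (∃ λ x → ∃ λ y → _<_ P x y)
       × ¬ (∃ λ x → ∃ λ y → ∃ λ z → _<_ P x y × _<_ P y z)

Monotone : (P Q : FinPoset) → (Carrier P → Carrier Q) → Set
Monotone P Q g = ∀ x y → _≤_ P x y → _≤_ Q (g x) (g y)

-- f : E(P) → Q is an order homomorphism for the induced order on E(P).
-- f is given as a total function on Carrier P; only its values on E(P) matter.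
MonotoneOnE : (P Q : FinPoset) → (Carrier P → Carrier Q) → Set
MonotoneOnE P Q f = ∀ x y → Extremal P x → Extremal P y → _≤_ P x y → _≤_ Q (f x) (f y)

AtLeastTwo : {A : Set} → (A → Set) → Set
AtLeastTwo {A} S = ∃ λ a → ∃ λ b → S a × S b × a ≢ b

ExactlyOne : {A : Set} → (A → Set) → Set
ExactlyOne {A} S = ∃ λ a → S a × (∀ b → S b → b ≡ a)

Disjoint : {A : Set} → (A → Set) → (A → Set) → Set
Disjoint {A} S T = ¬ (∃ λ a → S a × T a)

α : (P Q : FinPoset) → (Carrier P → Carrier Q) → Carrier P → Carrier Q → Set
α P Q f x q = ∃ λ l → Minimal P l × _≤_ P l x × f l ≡ q

β : (P Q : FinPoset) → (Carrier P → Carrier Q) → Carrier P → Carrier Q → Set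
β P Q f x q = ∃ λ u → Maximal P u × _≤_ P x u × f u ≡ q

{-# OPTIONS --safe #-}
-- Keep f on maximal points. At any other x, fix a minimal l ≤ x and a maximal u ≥ x;
-- if f is constant on the minimal points below x (i.e. α(x) = {f l}) put g x = f l,
-- otherwise g x = f u. In the second case α(x) has two points and β(x) = {f u}:
-- if α(x) and β(x) are disjoint this is the hypothesis, and if they share a point q,
-- then q lies above two distinct points of the flat poset Q, so q is maximal and
-- every point of β(x), lying above q, equals q. In every case g x lies below β(x),
-- which gives monotonicity.
module Submission where

open import Defs
open import Data.Nat using () renaming (_≤_ to _≤ℕ_)
open import Data.Product using (∃; _×_; _,_; proj₁; proj₂)
open import Data.Sum using (_⊎_; inj₁; inj₂)
open import Data.Empty using (⊥-elim)
open import Data.Fin using (_≟_)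
open import Data.Fin.Properties using (all?; any?)
open import Data.List using (List; []; _∷_; allFin)
open import Data.List.Relation.Unary.Any using (here; there)
open import Data.List.Membership.Propositional using (_∈_)
open import Data.List.Membership.Propositional.Properties using (∈-allFin)
open import Function using (flip)
open import Relation.Nullary using (¬_; Dec; yes; no)
open import Relation.Nullary.Decidable using (_→-dec_; _×-dec_; ¬?; decidable-stable)
open import Relation.Binary.PropositionalEquality using (_≡_; _≢_; ≢-sym; refl; sym; trans; cong; subst)
open import Relation.Binary.Structures using (IsPartialOrder)
import Relation.Binary.Construct.Flip.EqAndOrd as Flip

dual : FinPoset → FinPoset
dual P = record
  { size           = size P
  ; _≤_            = flip (_≤_ P)
  ; isPartialOrder = Flip.isPartialOrder (isPartialOrder P)
  ; _≤?_           = flip (_≤?_ P)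
  }

module _ (P : FinPoset) where
  open IsPartialOrder (isPartialOrder P) using (antisym) renaming (refl to ≤-refl; trans to ≤-trans)

  minimal-among : ∀ (ys : List (Carrier P)) x →
    ∃ λ l → _≤_ P l x × (∀ y → y ∈ ys → _≤_ P y l → y ≡ l)
  minimal-among [] x = x , ≤-refl , λ _ ()
  minimal-among (y ∷ ys) x with minimal-among ys x
  ... | l , l≤x , l-min with _≤?_ P y l
  ...   | no  y≰l = l , l≤x , λ { _ (here refl) y≤l → ⊥-elim (y≰l y≤l)
                                ; z (there z∈ys) z≤l → l-min z z∈ys z≤l }
  ...   | yes y≤l = y , ≤-trans y≤l l≤x , λ { _ (here refl) _ → refl
                                            ; z (there z∈ys) z≤y → z≡y z∈ys z≤y }
    where
    z≡y : ∀ {z} → z ∈ ys → _≤_ P z y → z ≡ y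
    z≡y {z} z∈ys z≤y with l-min z z∈ys (≤-trans z≤y y≤l)
    ... | refl = antisym z≤y y≤l

  minimal-below : ∀ x → ∃ λ l → Minimal P l × _≤_ P l x
  minimal-below x with minimal-among (allFin _) x
  ... | l , l≤x , l-min = l , (λ y → l-min y (∈-allFin y)) , l≤x

  Minimal? : ∀ x → Dec (Minimal P x)
  Minimal? x = all? λ y → _≤?_ P y x →-dec y ≟ x

maximal-above : (P : FinPoset) → ∀ x → ∃ λ u → Maximal P u × _≤_ P x u
maximal-above P = minimal-below (dual P)

Maximal? : (P : FinPoset) → ∀ x → Dec (Maximal P x)
Maximal? P = Minimal? (dual P)

flat-upper-bound-of-two-is-maximal : ∀ Q → Flat Q → ∀ {a₁ a₂ q} → a₁ ≢ a₂ →
  _≤_ Q a₁ q → _≤_ Q a₂ q → Maximal Q q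
flat-upper-bound-of-two-is-maximal Q (_ , no-3-chain) {a₁} {a₂} {q} a₁≢a₂ a₁≤q a₂≤q b q≤b
  with b ≟ q | a₁ ≟ q
... | yes b≡q | _        = b≡q
... | no  b≢q | no  a₁≢q = ⊥-elim (no-3-chain (a₁ , q , b , (a₁≤q , a₁≢q) , (q≤b , ≢-sym b≢q)))
... | no  b≢q | yes refl = ⊥-elim (no-3-chain (a₂ , q , b , (a₂≤q , ≢-sym a₁≢a₂) , (q≤b , ≢-sym b≢q)))

module Extension (P Q : FinPoset) (flatQ : Flat Q) (f : Carrier P → Carrier Q)
  (f-mono : MonotoneOnE P Q f)
  (hyp : ∀ x → Disjoint (α P Q f x) (β P Q f x) →
    (AtLeastTwo (α P Q f x) → ExactlyOne (β P Q f x)) ×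
    (AtLeastTwo (β P Q f x) → ExactlyOne (α P Q f x))) where

  open IsPartialOrder (isPartialOrder P) using () renaming (trans to ⊑-trans)
  open IsPartialOrder (isPartialOrder Q) using () renaming (reflexive to ≼-reflexive)

  X : Set
  X = Carrier P
  _⊑_ : X → X → Set
  _⊑_ = _≤_ P
  _≼_ : Carrier Q → Carrier Q → Set
  _≼_ = _≤_ Q

  low : X → X
  low x = proj₁ (minimal-below P x)
  high : X → X
  high x = proj₁ (maximal-above P x)

  low-minimal : ∀ x → Minimal P (low x)
  low-minimal x = proj₁ (proj₂ (minimal-below P x))
  low⊑ : ∀ x → low x ⊑ x
  low⊑ x = proj₂ (proj₂ (minimal-below P x))
  high-maximal : ∀ x → Maximal P (high x)
  high-maximal x = proj₁ (proj₂ (maximal-above P x))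
  ⊑high : ∀ x → x ⊑ high x
  ⊑high x = proj₂ (proj₂ (maximal-above P x))

  f-low∈α : ∀ x → α P Q f x (f (low x))
  f-low∈α x = low x , low-minimal x , low⊑ x , refl
  f-high∈β : ∀ x → β P Q f x (f (high x))
  f-high∈β x = high x , high-maximal x , ⊑high x , refl

  α≼β : ∀ {x a b} → α P Q f x a → β P Q f x b → a ≼ b
  α≼β (l , l-min , l⊑x , refl) (u , u-max , x⊑u , refl) =
    f-mono l u (inj₁ l-min) (inj₂ u-max) (⊑-trans l⊑x x⊑u)

  α-mono : ∀ {x y a} → x ⊑ y → α P Q f x a → α P Q f y a
  α-mono x⊑y (l , l-min , l⊑x , fl≡a) = l , l-min , ⊑-trans l⊑x x⊑y , fl≡a

  β-antitone : ∀ {x y b} → x ⊑ y → β P Q f y b → β P Q f x b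
  β-antitone x⊑y (u , u-max , y⊑u , fu≡b) = u , u-max , ⊑-trans x⊑y y⊑u , fu≡b

  spread-mono : ∀ {x y} → x ⊑ y → AtLeastTwo (α P Q f x) → AtLeastTwo (α P Q f y)
  spread-mono x⊑y (a₁ , a₂ , a₁∈α , a₂∈α , a₁≢a₂) =
    a₁ , a₂ , α-mono x⊑y a₁∈α , α-mono x⊑y a₂∈α , a₁≢a₂

  spread⇒β-unique : ∀ {x b b′} → AtLeastTwo (α P Q f x) →
    β P Q f x b → β P Q f x b′ → b ≡ b′
  spread⇒β-unique {x} {b} {b′} two@(_ , _ , a₁∈α , a₂∈α , a₁≢a₂) b∈β b′∈β =
    decidable-stable (b ≟ b′) λ b≢b′ → b≢b′ (unique-by-hyp (disjoint b≢b′))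
    where
    disjoint : b ≢ b′ → Disjoint (α P Q f x) (β P Q f x)
    disjoint b≢b′ (q , q∈α , q∈β) = b≢b′ (trans (q-max b (α≼β q∈α b∈β)) (sym (q-max b′ (α≼β q∈α b′∈β))))
      where
      q-max : Maximal Q q
      q-max = flat-upper-bound-of-two-is-maximal Q flatQ a₁≢a₂ (α≼β a₁∈α q∈β) (α≼β a₂∈α q∈β)
    unique-by-hyp : Disjoint (α P Q f x) (β P Q f x) → b ≡ b′
    unique-by-hyp disj with proj₁ (hyp x disj) two
    ... | _ , _ , only = trans (only b b∈β) (sym (only b′ b′∈β))

  Uniform : X → Set
  Uniform x = ∀ a → α P Q f x a → a ≡ f (low x)

  uniform⇒¬spread : ∀ {x} → Uniform x → ¬ AtLeastTwo (α P Q f x)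
  uniform⇒¬spread uni (a₁ , a₂ , a₁∈α , a₂∈α , a₁≢a₂) = a₁≢a₂ (trans (uni a₁ a₁∈α) (sym (uni a₂ a₂∈α)))

  uniform-or-spread : ∀ x → Uniform x ⊎ AtLeastTwo (α P Q f x)
  uniform-or-spread x with any? (λ l → Minimal? P l ×-dec _≤?_ P l x ×-dec ¬? (f l ≟ f (low x)))
  ... | yes (l , l-min , l⊑x , fl≢) = inj₂ (f l , f (low x) , (l , l-min , l⊑x , refl) , f-low∈α x , fl≢)
  ... | no none = inj₁ λ { _ (l , l-min , l⊑x , refl) →
          decidable-stable (f l ≟ f (low x)) λ fl≢ → none (l , l-min , l⊑x , fl≢) }

  data Value (x : X) : Carrier Q → Set where
    at-maximal : Maximal P x → Value x (f x)
    at-uniform : ¬ Maximal P x → Uniform x → Value x (f (low x))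
    at-spread  : AtLeastTwo (α P Q f x) → Value x (f (high x))

  g : X → Carrier Q
  g x with Maximal? P x | uniform-or-spread x
  ... | yes _ | _      = f x
  ... | no _  | inj₁ _ = f (low x)
  ... | no _  | inj₂ _ = f (high x)

  g-value : ∀ x → Value x (g x)
  g-value x with Maximal? P x | uniform-or-spread x
  ... | yes x-max    | _          = at-maximal x-max
  ... | no x-nonmax  | inj₁ uni   = at-uniform x-nonmax uni
  ... | no _         | inj₂ two   = at-spread two

  value≼β : ∀ {x v b} → Value x v → β P Q f x b → v ≼ b
  value≼β {x} (at-maximal x-max) (u , u-max , x⊑u , refl) = f-mono x u (inj₂ x-max) (inj₂ u-max) x⊑u
  value≼β {x} (at-uniform _ _) b∈β = α≼β (f-low∈α x) b∈β
  value≼β {x} (at-spread two)  b∈β = ≼-reflexive (spread⇒β-unique two (f-high∈β x) b∈β)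

  value-mono : ∀ {x y v w} → x ⊑ y → Value x v → Value y w → v ≼ w
  value-mono {y = y} x⊑y vx (at-maximal y-max) = value≼β vx (y , y-max , x⊑y , refl)
  value-mono {y = y} x⊑y vx (at-spread _)      = value≼β vx (β-antitone x⊑y (f-high∈β y))
  value-mono {x} {y} x⊑y (at-maximal x-max) (at-uniform y-nonmax _) =
    ⊥-elim (y-nonmax (subst (Maximal P) (sym (x-max y x⊑y)) x-max))
  value-mono {x} x⊑y (at-uniform _ _) (at-uniform _ y-uni) = ≼-reflexive (y-uni _ (α-mono x⊑y (f-low∈α x)))
  value-mono x⊑y (at-spread two) (at-uniform _ y-uni) = ⊥-elim (uniform⇒¬spread y-uni (spread-mono x⊑y two))

  value-extends : ∀ {x v} → Extremal P x → Value x v → v ≡ f x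
  value-extends _ (at-maximal _) = refl
  value-extends (inj₁ x-min) (at-uniform _ _) = cong f (x-min _ (low⊑ _))
  value-extends (inj₂ x-max) (at-uniform x-nonmax _) = ⊥-elim (x-nonmax x-max)
  value-extends (inj₁ x-min) (at-spread (_ , _ , (l₁ , _ , l₁⊑x , refl) , (l₂ , _ , l₂⊑x , refl) , fl₁≢fl₂)) =
    ⊥-elim (fl₁≢fl₂ (cong f (trans (x-min l₁ l₁⊑x) (sym (x-min l₂ l₂⊑x)))))
  value-extends (inj₂ x-max) (at-spread _) = cong f (x-max _ (⊑high _))

  g-monotone : Monotone P Q g
  g-monotone x y x⊑y = value-mono x⊑y (g-value x) (g-value y)

  g-extends-f : ∀ x → Extremal P x → g x ≡ f x
  g-extends-f x x-ext = value-extends x-ext (g-value x)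

proposition1 : (P Q : FinPoset) → Connected P → 2 ≤ℕ size P → Connected Q → Flat Q →
    (f : Carrier P → Carrier Q) → MonotoneOnE P Q f →
    (∀ x → Disjoint (α P Q f x) (β P Q f x) →
      (AtLeastTwo (α P Q f x) → ExactlyOne (β P Q f x)) ×
      (AtLeastTwo (β P Q f x) → ExactlyOne (α P Q f x))) →
    ∃ λ (g : Carrier P → Carrier Q) → Monotone P Q g × (∀ x → Extremal P x → g x ≡ f x)
proposition1 P Q _ _ _ flatQ f f-mono hyp = g , g-monotone , g-extends-f
  where open Extension P Q flatQ f f-mono hyp
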